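{- Let $\mathbb{B}$ be an approximant and $\beta_1,\dots,\beta_n$ names not occurring in $\mathbb{B}$. Then $\mathbb{B}\{\alpha\leftarrow\lambda x.\langle\cdot\rangle_\alpha\}$ and $\mathbb{B}\{\alpha\leftarrow x\,\langle\cdot\rangle_{\beta_1}\cdots\langle\cdot\rangle_{\beta_n}\}$ are approximants.
   Context: Named multi-contexts $\mathbb{C} ::= x\mid\langle\cdot\rangle_\alpha\mid\lambda x.\mathbb{C}\mid\mathbb{C}\,\mathbb{C}$ ($\alpha$ ranging over names, $x$ over variables); $\mathbb{C}\{\alpha\leftarrow\mathbb{C}'\}$ is the capture-allowing replacement of the named hole $\langle\cdot\rangle_\alpha$ by $\mathbb{C}'$. Approximants $\mathbb{B}$ and rigid approximants $\mathbb{R}$ are defined by $\mathbb{B} ::= \langle\cdot\rangle_\alpha\mid\mathbb{R}\mid\lambda x.\mathbb{B}$ and $\mathbb{R} ::= x\mid\mathbb{R}\,\mathbb{B}$. -}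

module Defs where

open import Data.Nat using (ℕ)
open import Data.List using (List; foldl; map)
open import Data.Bool using (if_then_else_)
open import Relation.Nullary using (¬_)
open import Relation.Nullary.Decidable using (⌊_⌋)
open import Data.Nat.Properties using (_≟_)

-- Variables and names are both represented by natural numbers
-- (two disjoint syntactic categories; only equality on names is needed).
Var : Set
Var = ℕ

Name : Set
Name = ℕ

data MCtx : Set where
  var  : Var → MCtx
  hole : Name → MCtx
  lam  : Var → MCtx → MCtx
  app  : MCtx → MCtx → MCtx

-- Capture-allowing replacement C{α ← C'} of every named hole ⟨·⟩_α by C'.
_⟦_←_⟧ : MCtx → Name → MCtx → MCtx
var x   ⟦ α ← C' ⟧ = var x
hole β  ⟦ α ← C' ⟧ = if ⌊ β ≟ α ⌋ then C' else hole β
lam x C ⟦ α ← C' ⟧ = lam x (C ⟦ α ← C' ⟧)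
app C D ⟦ α ← C' ⟧ = app (C ⟦ α ← C' ⟧) (D ⟦ α ← C' ⟧)

data NameOccurs (β : Name) : MCtx → Set where
  here : NameOccurs β (hole β)
  lam  : ∀ {x C} → NameOccurs β C → NameOccurs β (lam x C)
  appˡ : ∀ {C D} → NameOccurs β C → NameOccurs β (app C D)
  appʳ : ∀ {C D} → NameOccurs β D → NameOccurs β (app C D)

mutual
  data Approx : MCtx → Set where
    hole  : ∀ α → Approx (hole α)
    rigid : ∀ {R} → Rigid R → Approx R
    lam   : ∀ x {B} → Approx B → Approx (lam x B)

  data Rigid : MCtx → Set where
    var : ∀ x → Rigid (var x)
    app : ∀ {R B} → Rigid R → Approx B → Rigid (app R B)

appHoles : Var → List Name → MCtx
appHoles x βs = foldl app (var x) (map hole βs)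

module Submission where

open import Defs
open import Data.Bool using (true; false)
open import Data.List using (List; []; _∷_; foldl; map)
open import Data.List.Relation.Unary.All using (All)
open import Data.Nat.Properties using (_≟_)
open import Data.Product using (_×_; _,_)
open import Relation.Nullary using (¬_)
open import Relation.Nullary.Decidable using (⌊_⌋)

-- A hole sits exactly where the grammar allows an arbitrary approximant.
mutual
  Approx-⟦←⟧ : ∀ {B C} α → Approx C → Approx B → Approx (B ⟦ α ← C ⟧)
  Approx-⟦←⟧ α aC (hole β) with ⌊ β ≟ α ⌋
  ... | true  = aC
  ... | false = hole β
  Approx-⟦←⟧ α aC (rigid r) = rigid (Rigid-⟦←⟧ α aC r)
  Approx-⟦←⟧ α aC (lam x a) = lam x (Approx-⟦←⟧ α aC a)

  Rigid-⟦←⟧ : ∀ {R C} α → Approx C → Rigid R → Rigid (R ⟦ α ← C ⟧)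
  Rigid-⟦←⟧ α aC (var x)   = var x
  Rigid-⟦←⟧ α aC (app r a) = app (Rigid-⟦←⟧ α aC r) (Approx-⟦←⟧ α aC a)

Rigid-foldl-app-holes : ∀ {R} (βs : List Name) → Rigid R → Rigid (foldl app R (map hole βs))
Rigid-foldl-app-holes []       r = r
Rigid-foldl-app-holes (β ∷ βs) r = Rigid-foldl-app-holes βs (app r (hole β))

Approx-appHoles : ∀ x (βs : List Name) → Approx (appHoles x βs)
Approx-appHoles x βs = rigid (Rigid-foldl-app-holes βs (var x))

lemma1 : (B : MCtx) (α : Name) (x : Var) (βs : List Name)
         → Approx B
         → All (λ β → ¬ NameOccurs β B) βs
         → Approx (B ⟦ α ← lam x (hole α) ⟧)
           × Approx (B ⟦ α ← appHoles x βs ⟧)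
lemma1 B α x βs aB _ =
  Approx-⟦←⟧ α (lam x (hole α)) aB , Approx-⟦←⟧ α (Approx-appHoles x βs) aB
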